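{- Let $m, d$ be positive integers with $2^{d-1} \leq 2m < 2^d$. If $m \neq 2^{d-1}-2$, then $\beta_{2m}(d) = 2m+2$; if $m = 2^{d-1}-2$, then $\beta_{2m}(d) = 2m$.
   Context: $\beta_{2m}(d)$ denotes the largest size of a set $A \subseteq \mathbb{Z}_2^d$ (of distinct elements) which has no subset $B\subseteq A$ with $|B| = 2m$ and $\sum_{x\in B} x = 0$. -}

module Defs where

open import Data.Bool using (Bool; false; _xor_)
open import Data.Nat using (ℕ; _≤_)
open import Data.Vec using (Vec; replicate; zipWith)
open import Data.List using (List; length; foldr)
open import Data.List.Relation.Unary.Unique.Propositional using (Unique)
open import Data.List.Relation.Binary.Sublist.Propositional using (_⊆_)
open import Data.Product using (Σ; _×_)
open import Relation.Binary.PropositionalEquality using (_≡_)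
open import Relation.Nullary using (¬_)

Z2^ : ℕ → Set
Z2^ d = Vec Bool d

zero^ : (d : ℕ) → Z2^ d
zero^ d = replicate d false

_⊕_ : {d : ℕ} → Z2^ d → Z2^ d → Z2^ d
_⊕_ = zipWith _xor_

vsum : {d : ℕ} → List (Z2^ d) → Z2^ d
vsum {d} = foldr _⊕_ (zero^ d)

-- A finite set A ⊆ Z_2^d is a duplicate-free list; its subsets are its sublists.
-- A is "2m-zero-sum-free" if no subset B of size 2m sums to 0.
ZeroSumFree : (d k : ℕ) → List (Z2^ d) → Set
ZeroSumFree d k A =
  (B : List (Z2^ d)) → B ⊆ A → length B ≡ k → ¬ (vsum B ≡ zero^ d)

Admissible : (d k : ℕ) → List (Z2^ d) → Set
Admissible d k A = Unique A × ZeroSumFree d k A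

IsBeta : (k d n : ℕ) → Set
IsBeta k d n =
  Σ (List (Z2^ d)) (λ A → Admissible d k A × length A ≡ n)
  × ((A : List (Z2^ d)) → Admissible d k A → length A ≤ n)

module Submission where

-- Exact values of β_{2m}(d) for 2^{d-1} ≤ 2m < 2^d; write d = e + 1.
-- Key fact (tripleWithSum): 2^e + 3 distinct vectors of Z_2^{e+1} contain three
-- distinct ones with any prescribed sum s (pick x ≠ s; by pigeonhole the rest
-- contains y and y ⊕ x ⊕ s).  With s the total sum of a (k+3)-set, the rest of
-- the set is a zero-sum k-subset (zeroSumSubset).  So for 2^e ≤ k, β_k ≤ k + 2
-- (upperBound), and β_k ≥ k + 2 when k + 5 ≤ 2^{e+1} or k + 2 = 2^{e+1}, since
-- a zero-sum (k+2)-set is k-admissible: a k-subset omits two distinct vectors,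
-- which cannot sum to zero (lowerBound, lowerBound-full).  When 2m + 4 = 2^d,
-- any 2m + 1 vectors contain a zero-sum 2m-subset (drop their sum s if present;
-- otherwise s and the vectors omit exactly two vectors of the zero-sum space
-- Z_2^d), and 2m vectors with nonzero sum are admissible (upperBound-tight,
-- lowerBound-tight).

open import Defs
open import Data.Nat using (ℕ; _≤_; _<_; _*_; _^_; _∸_; _+_; zero; suc; z≤n; s≤s; _≤?_)
open import Data.Nat.Properties
  using (≤-trans; ≤-pred; <⇒≱; ≰⇒>; ≤∧≢⇒<; n≤1+n; m≤m+n; m≤n⇒m⊓n≡m; m∸n+n≡m; suc-injective;
         +-comm; +-assoc; +-identityʳ; +-cancelˡ-≡; +-monoʳ-≤; *-monoʳ-≤; *-monoʳ-<; *-cancelˡ-<)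
  renaming (_≟_ to _≟ℕ_)
open import Data.Nat.Tactic.RingSolver using (solve-∀)
open import Relation.Binary.PropositionalEquality
  using (_≡_; _≢_; refl; sym; trans; cong; cong₂; subst; module ≡-Reasoning)
open import Data.Product using (_×_; Σ; _,_)
open import Data.Bool using (Bool; true; false; _xor_)
open import Data.Bool.Properties using (xor-assoc; xor-comm; xor-identityˡ; xor-identityʳ; xor-same)
  renaming (_≟_ to _≟𝔹_)
open import Data.Vec using ([]; _∷_)
open import Data.Vec.Properties using (zipWith-assoc; zipWith-comm; zipWith-identityˡ; zipWith-identityʳ; ≡-dec; ∷-injectiveʳ)
open import Data.List using (List; []; _∷_; length; map; take; _++_)
open import Data.List.Properties using (length-++; length-map; length-take)
open import Data.List.Relation.Unary.Unique.Propositional using (Unique)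
import Data.List.Relation.Unary.Unique.Propositional.Properties as Unique
open import Data.List.Relation.Unary.AllPairs using ([]; _∷_)
open import Data.List.Relation.Unary.All using ([]; _∷_)
import Data.List.Relation.Unary.All as All
open import Data.List.Relation.Unary.All.Properties using (¬Any⇒All¬)
open import Data.List.Relation.Unary.Any using (here; there; any?)
open import Data.List.Membership.Propositional using (_∈_; _∉_; find; lose)
open import Data.List.Membership.Propositional.Properties using (∈-++⁺ˡ; ∈-++⁺ʳ; ∈-map⁺; ∈-map⁻)
open import Data.List.Relation.Binary.Sublist.Propositional using (_⊆_; []; _∷_; _∷ʳ_; ⊆-refl; ⊆-trans)
open import Data.List.Relation.Binary.Sublist.Propositional.Properties
  using (All-resp-⊆; Any-resp-⊆; to-≋; take-⊆)
open import Data.List.Relation.Binary.Equality.Propositional using (≋⇒≡)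
open import Data.List.Relation.Binary.Subset.Propositional using () renaming (_⊆_ to _⊑_)
open import Data.Empty using (⊥-elim)
open import Relation.Nullary using (¬_; Dec; yes; no)

⊕-assoc : ∀ {d} (x y z : Z2^ d) → (x ⊕ y) ⊕ z ≡ x ⊕ (y ⊕ z)
⊕-assoc = zipWith-assoc xor-assoc

⊕-comm : ∀ {d} (x y : Z2^ d) → x ⊕ y ≡ y ⊕ x
⊕-comm = zipWith-comm xor-comm

⊕-identityˡ : ∀ {d} (x : Z2^ d) → zero^ d ⊕ x ≡ x
⊕-identityˡ = zipWith-identityˡ xor-identityˡ

⊕-identityʳ : ∀ {d} (x : Z2^ d) → x ⊕ zero^ d ≡ x
⊕-identityʳ = zipWith-identityʳ xor-identityʳ

⊕-self : ∀ {d} (x : Z2^ d) → x ⊕ x ≡ zero^ d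
⊕-self []      = refl
⊕-self (a ∷ x) = cong₂ _∷_ (xor-same a) (⊕-self x)

⊕-cancelˡ : ∀ {d} (x y : Z2^ d) → x ⊕ (x ⊕ y) ≡ y
⊕-cancelˡ {d} x y = begin
  x ⊕ (x ⊕ y)   ≡⟨ sym (⊕-assoc x x y) ⟩
  (x ⊕ x) ⊕ y   ≡⟨ cong (_⊕ y) (⊕-self x) ⟩
  zero^ d ⊕ y   ≡⟨ ⊕-identityˡ y ⟩
  y             ∎
  where open ≡-Reasoning

⊕-injectiveˡ : ∀ {d} (x y z : Z2^ d) → x ⊕ y ≡ x ⊕ z → y ≡ z
⊕-injectiveˡ x y z eq = trans (sym (⊕-cancelˡ x y)) (trans (cong (x ⊕_) eq) (⊕-cancelˡ x z))

⊕≡zero⇒≡ : ∀ {d} (x y : Z2^ d) → x ⊕ y ≡ zero^ d → x ≡ y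
⊕≡zero⇒≡ x y eq = sym (⊕-injectiveˡ x y x (trans eq (sym (⊕-self x))))

⊕-absorbs⇒zero : ∀ {d} (x y : Z2^ d) → x ≡ x ⊕ y → y ≡ zero^ d
⊕-absorbs⇒zero x y eq = ⊕-injectiveˡ x y _ (trans (sym eq) (sym (⊕-identityʳ x)))

vsum-++ : ∀ {d} (X Y : List (Z2^ d)) → vsum (X ++ Y) ≡ vsum X ⊕ vsum Y
vsum-++ [] Y      = sym (⊕-identityˡ (vsum Y))
vsum-++ (x ∷ X) Y = trans (cong (x ⊕_) (vsum-++ X Y)) (sym (⊕-assoc x (vsum X) (vsum Y)))

_≟_ : ∀ {d} (x y : Z2^ d) → Dec (x ≡ y)
_≟_ = ≡-dec _≟𝔹_

_∈?_ : ∀ {d} (x : Z2^ d) (xs : List (Z2^ d)) → Dec (x ∈ xs)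
x ∈? xs = any? (x ≟_) xs

Unique-⊆ : ∀ {A : Set} {xs ys : List A} → xs ⊆ ys → Unique ys → Unique xs
Unique-⊆ []          []       = []
Unique-⊆ (_ ∷ʳ sub)  (_ ∷ u)  = Unique-⊆ sub u
Unique-⊆ (refl ∷ sub) (a ∷ u) = All-resp-⊆ sub a ∷ Unique-⊆ sub u

subsetOfSize : ∀ {A : Set} k (xs : List A) → k ≤ length xs →
  Σ (List A) λ ys → ys ⊆ xs × length ys ≡ k
subsetOfSize k xs k≤ = take k xs , take-⊆ k xs , trans (length-take k xs) (m≤n⇒m⊓n≡m k≤)

⊆∧length≡⇒≡ : ∀ {A : Set} {xs ys : List A} → xs ⊆ ys → length xs ≡ length ys → xs ≡ ys
⊆∧length≡⇒≡ sub eq = ≋⇒≡ (to-≋ eq sub)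

remove : ∀ {A : Set} {x : A} {xs : List A} → x ∈ xs → List A
remove {xs = _ ∷ xs} (here _)  = xs
remove {xs = y ∷ _}  (there p) = y ∷ remove p

remove-⊆ : ∀ {A : Set} {x : A} {xs} (p : x ∈ xs) → remove p ⊆ xs
remove-⊆ {xs = y ∷ _} (here _) = y ∷ʳ ⊆-refl
remove-⊆ (there p)             = refl ∷ remove-⊆ p

remove-length : ∀ {A : Set} {x : A} {xs} (p : x ∈ xs) → length xs ≡ suc (length (remove p))
remove-length (here _)  = refl
remove-length (there p) = cong suc (remove-length p)

remove-sum : ∀ {d} {x : Z2^ d} {xs} (p : x ∈ xs) → vsum xs ≡ x ⊕ vsum (remove p)
remove-sum (here refl) = refl
remove-sum {x = x} {xs = y ∷ ys} (there p) = begin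
  y ⊕ vsum ys                  ≡⟨ cong (y ⊕_) (remove-sum p) ⟩
  y ⊕ (x ⊕ vsum (remove p))    ≡⟨ sym (⊕-assoc y x _) ⟩
  (y ⊕ x) ⊕ vsum (remove p)    ≡⟨ cong (_⊕ vsum (remove p)) (⊕-comm y x) ⟩
  (x ⊕ y) ⊕ vsum (remove p)    ≡⟨ ⊕-assoc x y _ ⟩
  x ⊕ (y ⊕ vsum (remove p))    ∎
  where open ≡-Reasoning

remove-keeps : ∀ {A : Set} {x z : A} {xs} (p : x ∈ xs) → z ∈ xs → z ≢ x → z ∈ remove p
remove-keeps (here refl) (here refl) z≢x = ⊥-elim (z≢x refl)
remove-keeps (here refl) (there q)   _   = q
remove-keeps (there p)   (here e)    _   = here e
remove-keeps (there p)   (there q)   z≢x = there (remove-keeps p q z≢x)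

remove-∉ : ∀ {A : Set} {x : A} {xs} → Unique xs → (p : x ∈ xs) → x ∉ remove p
remove-∉ (x≢xs ∷ _) (here refl) q           = All.lookup x≢xs q refl
remove-∉ (y≢ys ∷ _) (there p)   (here refl) = All.lookup y≢ys p refl
remove-∉ (_ ∷ u)    (there p)   (there q)   = remove-∉ u p q

complement : ∀ {d} (X Y : List (Z2^ d)) → Unique X → Unique Y → X ⊑ Y →
  Σ (List (Z2^ d)) λ C → C ⊆ Y × length Y ≡ length X + length C × vsum Y ≡ vsum X ⊕ vsum C
complement [] Y _ _ _ = Y , ⊆-refl , refl , sym (⊕-identityˡ (vsum Y))
complement (x ∷ X) Y (x≢X ∷ uX) uY X⊆Y with X⊆Y (here refl)
... | x∈Y with complement X (remove x∈Y) uX (Unique-⊆ (remove-⊆ x∈Y) uY)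
                 (λ v∈X → remove-keeps x∈Y (X⊆Y (there v∈X)) (λ v≡x → All.lookup x≢X v∈X (sym v≡x)))
... | C , C⊆ , len , sum = C , ⊆-trans C⊆ (remove-⊆ x∈Y) , trans (remove-length x∈Y) (cong suc len) ,
  trans (remove-sum x∈Y) (trans (cong (x ⊕_) sum) (sym (⊕-assoc x (vsum X) (vsum C))))

allVectors : (d : ℕ) → List (Z2^ d)
allVectors zero    = [] ∷ []
allVectors (suc d) = map (false ∷_) (allVectors d) ++ map (true ∷_) (allVectors d)

allVectors-complete : ∀ {d} (v : Z2^ d) → v ∈ allVectors d
allVectors-complete []                = here refl
allVectors-complete {suc d} (false ∷ v) = ∈-++⁺ˡ (∈-map⁺ (false ∷_) (allVectors-complete v))
allVectors-complete {suc d} (true ∷ v)  =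
  ∈-++⁺ʳ (map (false ∷_) (allVectors d)) (∈-map⁺ (true ∷_) (allVectors-complete v))

allVectors-unique : ∀ d → Unique (allVectors d)
allVectors-unique zero    = [] ∷ []
allVectors-unique (suc d) =
  Unique.++⁺ (Unique.map⁺ ∷-injectiveʳ (allVectors-unique d)) (Unique.map⁺ ∷-injectiveʳ (allVectors-unique d)) halvesDisjoint
  where
  halvesDisjoint : ∀ {v} → ¬ (v ∈ map (false ∷_) (allVectors d) × v ∈ map (true ∷_) (allVectors d))
  halvesDisjoint (p , q) with ∈-map⁻ (false ∷_) p | ∈-map⁻ (true ∷_) q
  ... | _ , _ , refl | _ , _ , ()

allVectors-length : ∀ d → length (allVectors d) ≡ 2 ^ d
allVectors-length zero    = refl
allVectors-length (suc d) = begin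
  length (map (false ∷_) A ++ map (true ∷_) A)        ≡⟨ length-++ (map (false ∷_) A) ⟩
  length (map (false ∷_) A) + length (map (true ∷_) A) ≡⟨ cong₂ _+_ (length-map _ A) (length-map _ A) ⟩
  length A + length A                                  ≡⟨ cong₂ _+_ (allVectors-length d)
                                                            (trans (allVectors-length d) (sym (+-identityʳ _))) ⟩
  2 ^ suc d                                            ∎
  where
  open ≡-Reasoning
  A : List (Z2^ d)
  A = allVectors d

Unique⇒length≤ : ∀ {d} (X : List (Z2^ d)) → Unique X → length X ≤ 2 ^ d
Unique⇒length≤ {d} X uX with complement X (allVectors d) uX (allVectors-unique d) (λ {v} _ → allVectors-complete v)
... | C , _ , len , _ = subst (length X ≤_) (trans (sym len) (allVectors-length d)) (m≤m+n (length X) (length C))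

parity : ℕ → Bool
parity zero    = false
parity (suc n) = true xor parity n

parity-+ : ∀ m n → parity (m + n) ≡ parity m xor parity n
parity-+ zero    n = refl
parity-+ (suc m) n = trans (cong (true xor_) (parity-+ m n)) (sym (xor-assoc true (parity m) (parity n)))

vsum-map-false : ∀ {d} (X : List (Z2^ d)) → vsum (map (false ∷_) X) ≡ false ∷ vsum X
vsum-map-false []      = refl
vsum-map-false (x ∷ X) = cong ((false ∷ x) ⊕_) (vsum-map-false X)

vsum-map-true : ∀ {d} (X : List (Z2^ d)) → vsum (map (true ∷_) X) ≡ parity (length X) ∷ vsum X
vsum-map-true []      = refl
vsum-map-true (x ∷ X) = cong ((true ∷ x) ⊕_) (vsum-map-true X)

-- For d ≥ 2 the vectors of Z_2^d sum to zero: in the first coordinate the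
-- number 2^{d-1} of ones is even, and the other coordinates cancel in pairs.
allVectors-sum : ∀ e → vsum (allVectors (suc (suc e))) ≡ zero^ (suc (suc e))
allVectors-sum e = begin
  vsum (map (false ∷_) A ++ map (true ∷_) A)           ≡⟨ vsum-++ (map (false ∷_) A) (map (true ∷_) A) ⟩
  vsum (map (false ∷_) A) ⊕ vsum (map (true ∷_) A)     ≡⟨ cong₂ _⊕_ (vsum-map-false A) (vsum-map-true A) ⟩
  (false ∷ vsum A) ⊕ (parity (length A) ∷ vsum A)      ≡⟨ cong₂ _∷_ evenLength (⊕-self (vsum A)) ⟩
  zero^ (suc (suc e))                                  ∎
  where
  open ≡-Reasoning
  A : List (Z2^ (suc e))
  A = allVectors (suc e)
  evenLength : parity (length A) ≡ false
  evenLength = begin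
    parity (length A)               ≡⟨ cong parity (trans (allVectors-length (suc e)) (cong (2 ^ e +_) (+-identityʳ (2 ^ e)))) ⟩
    parity (2 ^ e + 2 ^ e)          ≡⟨ parity-+ (2 ^ e) (2 ^ e) ⟩
    parity (2 ^ e) xor parity (2 ^ e) ≡⟨ xor-same (parity (2 ^ e)) ⟩
    false                           ∎

-- Pigeonhole: more than 2^e elements of Z_2^{e+1} contain a pair {y, y ⊕ t},
-- for any t; otherwise L and its translate L ⊕ t would be disjoint, giving
-- more than 2^{e+1} distinct vectors.
pairWithDifference : ∀ {e} (L : List (Z2^ (suc e))) (t : Z2^ (suc e)) → Unique L → 2 ^ e < length L →
  Σ (Z2^ (suc e)) λ y → y ∈ L × (y ⊕ t) ∈ L
pairWithDifference {e} L t uL big with any? (λ y → (y ⊕ t) ∈? L) L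
... | yes pair = find pair
... | no noPair = ⊥-elim (<⇒≱ tooMany (Unique⇒length≤ (L ++ map (_⊕ t) L) uL∪L⊕t))
  where
  ⊕t-injective : ∀ {x y} → x ⊕ t ≡ y ⊕ t → x ≡ y
  ⊕t-injective {x} {y} eq = ⊕-injectiveˡ t x y (trans (⊕-comm t x) (trans eq (⊕-comm y t)))
  disjoint : ∀ {v} → ¬ (v ∈ L × v ∈ map (_⊕ t) L)
  disjoint (v∈L , v∈L⊕t) with ∈-map⁻ (_⊕ t) v∈L⊕t
  ... | y , y∈L , refl = noPair (lose y∈L v∈L)
  uL∪L⊕t : Unique (L ++ map (_⊕ t) L)
  uL∪L⊕t = Unique.++⁺ uL (Unique.map⁺ ⊕t-injective uL) disjoint
  tooMany : 2 ^ suc e < length (L ++ map (_⊕ t) L)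
  tooMany = subst (2 ^ suc e <_) (sym doubled) (*-monoʳ-< 2 big)
    where
    doubled : length (L ++ map (_⊕ t) L) ≡ 2 * length L
    doubled = trans (length-++ L) (cong (length L +_) (trans (length-map (_⊕ t) L) (sym (+-identityʳ _))))

memberAvoiding : ∀ {d} (L : List (Z2^ d)) (s : Z2^ d) → Unique L → 2 ≤ length L →
  Σ (Z2^ d) λ x → x ∈ L × x ≢ s
memberAvoiding (a ∷ b ∷ _) s ((a≢b ∷ _) ∷ _) (s≤s (s≤s z≤n)) with a ≟ s
... | yes refl = b , there (here refl) , λ b≡a → a≢b (sym b≡a)
... | no a≢s   = a , here refl , a≢s

TripleWithSum : ∀ {d} → List (Z2^ d) → Z2^ d → Set
TripleWithSum {d} L s =
  Σ (List (Z2^ d)) λ X → Unique X × X ⊑ L × length X ≡ 3 × vsum X ≡ s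

-- Among 2^e + 3 distinct vectors of Z_2^{e+1} there are three distinct ones
-- with any prescribed sum s: some x ≠ s, and a pair y, y ⊕ (x ⊕ s) among the rest.
tripleWithSum : ∀ {e} (L : List (Z2^ (suc e))) (s : Z2^ (suc e)) → Unique L → 3 + 2 ^ e ≤ length L →
  TripleWithSum L s
tripleWithSum {e} L s uL big = extend (memberAvoiding L s uL (≤-trans (s≤s (s≤s z≤n)) big))
  where
  extend : Σ (Z2^ (suc e)) (λ x → x ∈ L × x ≢ s) → TripleWithSum L s
  extend (x , x∈L , x≢s) = complete (pairWithDifference L′ t (Unique-⊆ (remove-⊆ x∈L) uL) L′-big)
    where
    L′ : List (Z2^ (suc e))
    L′ = remove x∈L
    t : Z2^ (suc e)
    t = x ⊕ s
    L′-big : 2 ^ e < length L′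
    L′-big = ≤-trans (n≤1+n _) (≤-pred (subst (3 + 2 ^ e ≤_) (remove-length x∈L) big))
    complete : Σ (Z2^ (suc e)) (λ y → y ∈ L′ × (y ⊕ t) ∈ L′) → TripleWithSum L s
    complete (y , y∈L′ , z∈L′) = x ∷ y ∷ y ⊕ t ∷ [] , distinct , within , refl , sumIsS
      where
      x∉L′ : ∀ {v} → v ∈ L′ → x ≢ v
      x∉L′ v∈L′ x≡v = remove-∉ uL x∈L (subst (_∈ L′) (sym x≡v) v∈L′)
      y≢z : y ≢ y ⊕ t
      y≢z y≡z = x≢s (⊕≡zero⇒≡ x s (⊕-absorbs⇒zero y t y≡z))
      distinct : Unique (x ∷ y ∷ y ⊕ t ∷ [])
      distinct = (x∉L′ y∈L′ ∷ x∉L′ z∈L′ ∷ []) ∷ (y≢z ∷ []) ∷ [] ∷ []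
      within : x ∷ y ∷ y ⊕ t ∷ [] ⊑ L
      within (here refl)                 = x∈L
      within (there (here refl))         = Any-resp-⊆ (remove-⊆ x∈L) y∈L′
      within (there (there (here refl))) = Any-resp-⊆ (remove-⊆ x∈L) z∈L′
      sumIsS : x ⊕ (y ⊕ ((y ⊕ t) ⊕ zero^ (suc e))) ≡ s
      sumIsS = begin
        x ⊕ (y ⊕ ((y ⊕ t) ⊕ zero^ (suc e))) ≡⟨ cong (λ w → x ⊕ (y ⊕ w)) (⊕-identityʳ (y ⊕ t)) ⟩
        x ⊕ (y ⊕ (y ⊕ t))                   ≡⟨ cong (x ⊕_) (⊕-cancelˡ y t) ⟩
        x ⊕ (x ⊕ s)                         ≡⟨ ⊕-cancelˡ x s ⟩
        s                                   ∎
        where open ≡-Reasoning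

ZeroSumSubset : ∀ {d} → ℕ → List (Z2^ d) → Set
ZeroSumSubset {d} k L = Σ (List (Z2^ d)) λ B → B ⊆ L × length B ≡ k × vsum B ≡ zero^ d

ZeroSumSubset-⊆ : ∀ {d} {k} {L M : List (Z2^ d)} → L ⊆ M → ZeroSumSubset k L → ZeroSumSubset k M
ZeroSumSubset-⊆ L⊆M (B , B⊆L , |B| , ΣB) = B , ⊆-trans B⊆L L⊆M , |B| , ΣB

restSumsToZero : ∀ {d} k (X L : List (Z2^ d)) → Unique X → Unique L → X ⊑ L →
  vsum X ≡ vsum L → length L ≡ length X + k → ZeroSumSubset k L
restSumsToZero k X L uX uL X⊆L ΣX |L| with complement X L uX uL X⊆L
... | C , C⊆L , len , sum =
  C , C⊆L , +-cancelˡ-≡ (length X) (length C) k (trans (sym len) |L|) ,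
  ⊕-absorbs⇒zero (vsum L) (vsum C) (trans sum (cong (_⊕ vsum C) ΣX))

-- If 2^e ≤ k, any k + 3 distinct vectors of Z_2^{e+1} contain k summing to
-- zero: the complement of a triple whose sum is the total sum.
zeroSumSubset : ∀ {e} k (L : List (Z2^ (suc e))) → Unique L → 2 ^ e ≤ k → 3 + k ≤ length L →
  ZeroSumSubset k L
zeroSumSubset {e} k L uL k-big L-big = fromPrefix (subsetOfSize (3 + k) L L-big)
  where
  fromPrefix : Σ (List (Z2^ (suc e))) (λ O → O ⊆ L × length O ≡ 3 + k) → ZeroSumSubset k L
  fromPrefix (O , O⊆L , |O|) = fromTriple (tripleWithSum O (vsum O) uO O-big)
    where
    uO : Unique O
    uO = Unique-⊆ O⊆L uL
    O-big : 3 + 2 ^ e ≤ length O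
    O-big = subst (3 + 2 ^ e ≤_) (sym |O|) (+-monoʳ-≤ 3 k-big)
    fromTriple : TripleWithSum O (vsum O) → ZeroSumSubset k L
    fromTriple (X , uX , X⊆O , |X| , ΣX) =
      ZeroSumSubset-⊆ O⊆L (restSumsToZero k X O uX uO X⊆O ΣX (trans |O| (cong (_+ k) (sym |X|))))

AdmissibleOfSize : (d k n : ℕ) → Set
AdmissibleOfSize d k n = Σ (List (Z2^ d)) λ A → Admissible d k A × length A ≡ n

pairSum≢zero : ∀ {d} (C : List (Z2^ d)) → Unique C → length C ≡ 2 → vsum C ≢ zero^ d
pairSum≢zero (a ∷ b ∷ []) ((a≢b ∷ []) ∷ _) _ sum =
  a≢b (⊕≡zero⇒≡ a b (trans (cong (a ⊕_) (sym (⊕-identityʳ b))) sum))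

-- Inside a zero-sum set Y, a subset X leaving out exactly two elements has
-- nonzero sum, since the two left out would sum to zero.
missingPair⇒sum≢zero : ∀ {d} (X Y : List (Z2^ d)) → Unique X → Unique Y → X ⊑ Y →
  vsum Y ≡ zero^ d → length Y ≡ length X + 2 → vsum X ≢ zero^ d
missingPair⇒sum≢zero {d} X Y uX uY X⊆Y ΣY |Y| ΣX with complement X Y uX uY X⊆Y
... | C , C⊆Y , len , sum =
  pairSum≢zero C (Unique-⊆ C⊆Y uY) (+-cancelˡ-≡ (length X) _ _ (trans (sym len) |Y|)) ΣC
  where
  open ≡-Reasoning
  ΣC : vsum C ≡ zero^ d
  ΣC = begin
    vsum C             ≡⟨ sym (⊕-identityˡ (vsum C)) ⟩
    zero^ d ⊕ vsum C   ≡⟨ cong (_⊕ vsum C) (sym ΣX) ⟩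
    vsum X ⊕ vsum C    ≡⟨ sym sum ⟩
    vsum Y             ≡⟨ ΣY ⟩
    zero^ d            ∎

zeroSum⇒Admissible : ∀ {d} k (A : List (Z2^ d)) → Unique A → vsum A ≡ zero^ d → length A ≡ k + 2 →
  Admissible d k A
zeroSum⇒Admissible k A uA ΣA |A| = uA , λ B B⊆A |B| →
  missingPair⇒sum≢zero B A (Unique-⊆ B⊆A uA) uA (Any-resp-⊆ B⊆A) ΣA (trans |A| (cong (_+ 2) (sym |B|)))

-- A set of exactly k distinct vectors with nonzero sum is admissible for k:
-- its only k-subset is itself.
nonZeroSum⇒Admissible : ∀ {d} k (A : List (Z2^ d)) → Unique A → vsum A ≢ zero^ d → length A ≡ k →
  Admissible d k A
nonZeroSum⇒Admissible k A uA ΣA |A| = uA , λ B B⊆A |B| →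
  subst (λ X → vsum X ≢ zero^ _) (sym (⊆∧length≡⇒≡ B⊆A (trans |B| (sym |A|)))) ΣA

upperBoundFrom : ∀ {d} k n → (∀ (L : List (Z2^ d)) → Unique L → n < length L → ZeroSumSubset k L) →
  (A : List (Z2^ d)) → Admissible d k A → length A ≤ n
upperBoundFrom k n forced A (uA , zeroSumFree) = decide (length A ≤? n)
  where
  decide : Dec (length A ≤ n) → length A ≤ n
  decide (yes |A|≤n) = |A|≤n
  decide (no |A|≰n)  with forced A uA (≰⇒> |A|≰n)
  ... | B , B⊆A , |B| , ΣB = ⊥-elim (zeroSumFree B B⊆A |B| ΣB)

upperBound : ∀ {e} k → 2 ^ e ≤ k → (A : List (Z2^ (suc e))) → Admissible (suc e) k A → length A ≤ k + 2
upperBound k k-big = upperBoundFrom k (k + 2) λ L uL big →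
  zeroSumSubset k L uL k-big (subst (_≤ length L) (cong suc (+-comm k 2)) big)

-- If 2^{e+2} = k + 4, any k + 1 distinct vectors O contain k summing to zero:
-- drop their sum s if it is among them; otherwise s and O form a subset of
-- the zero-sum space Z_2^{e+2} that leaves out exactly two vectors, yet sums
-- to s ⊕ s = 0, contradicting missingPair⇒sum≢zero.
zeroSumSubset-tight : ∀ {e} k (O : List (Z2^ (suc (suc e)))) → Unique O → 2 ^ suc (suc e) ≡ k + 4 →
  length O ≡ suc k → ZeroSumSubset k O
zeroSumSubset-tight {e} k O uO space |O| = decide (vsum O ∈? O)
  where
  open ≡-Reasoning
  twoLeftOut : length (allVectors (suc (suc e))) ≡ suc (length O) + 2
  twoLeftOut = begin
    length (allVectors (suc (suc e))) ≡⟨ allVectors-length (suc (suc e)) ⟩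
    2 ^ suc (suc e)                   ≡⟨ space ⟩
    k + 4                             ≡⟨ +-comm k 4 ⟩
    suc (suc (2 + k))                 ≡⟨ cong (λ n → suc (suc n)) (+-comm 2 k) ⟩
    suc (suc k) + 2                   ≡⟨ cong (λ n → suc n + 2) (sym |O|) ⟩
    suc (length O) + 2                ∎
  decide : Dec (vsum O ∈ O) → ZeroSumSubset k O
  decide (yes s∈O) =
    remove s∈O , remove-⊆ s∈O , suc-injective (trans (sym (remove-length s∈O)) |O|) ,
    ⊕-absorbs⇒zero (vsum O) (vsum (remove s∈O)) (remove-sum s∈O)
  decide (no s∉O) = ⊥-elim (missingPair⇒sum≢zero (vsum O ∷ O) (allVectors _) (¬Any⇒All¬ O s∉O ∷ uO)
    (allVectors-unique _) (λ {v} _ → allVectors-complete v) (allVectors-sum e) twoLeftOut (⊕-self (vsum O)))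

upperBound-tight : ∀ {e} k → 2 ^ suc (suc e) ≡ k + 4 → (A : List (Z2^ (suc (suc e)))) →
  Admissible (suc (suc e)) k A → length A ≤ k
upperBound-tight k space = upperBoundFrom k k λ L uL big → fromPrefix L uL (subsetOfSize (suc k) L big)
  where
  fromPrefix : ∀ L → Unique L → Σ (List _) (λ O → O ⊆ L × length O ≡ suc k) → ZeroSumSubset k L
  fromPrefix L uL (O , O⊆L , |O|) = ZeroSumSubset-⊆ O⊆L (zeroSumSubset-tight k O (Unique-⊆ O⊆L uL) space |O|)

-- β_k(e+1) ≥ k + 2 when 2^e ≤ k and k + 5 ≤ 2^{e+1}: Z_2^{e+1} has a zero-sum
-- subset of size k + 2 by zeroSumSubset.
lowerBound : ∀ e k → 2 ^ e ≤ k → k + 5 ≤ 2 ^ suc e → AdmissibleOfSize (suc e) k (k + 2)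
lowerBound e k k-big k-small = fromSubset (zeroSumSubset (k + 2) V uV (≤-trans k-big (m≤m+n k 2)) enough)
  where
  V : List (Z2^ (suc e))
  V = allVectors (suc e)
  uV : Unique V
  uV = allVectors-unique (suc e)
  enough : 3 + (k + 2) ≤ length V
  enough = subst (_≤ length V) (sym (trans (+-comm 3 (k + 2)) (+-assoc k 2 3)))
             (subst (k + 5 ≤_) (sym (allVectors-length (suc e))) k-small)
  fromSubset : ZeroSumSubset (k + 2) V → AdmissibleOfSize (suc e) k (k + 2)
  fromSubset (A , A⊆V , |A| , ΣA) = A , zeroSum⇒Admissible k A (Unique-⊆ A⊆V uV) ΣA |A| , |A|

-- β_k(e+2) ≥ k + 2 when k + 2 = 2^{e+2}: the whole space sums to zero.
lowerBound-full : ∀ e k → 2 ^ suc (suc e) ≡ k + 2 → AdmissibleOfSize (suc (suc e)) k (k + 2)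
lowerBound-full e k space =
  allVectors _ , zeroSum⇒Admissible k _ (allVectors-unique (suc (suc e))) (allVectors-sum e) size , size
  where
  size : length (allVectors (suc (suc e))) ≡ k + 2
  size = trans (allVectors-length (suc (suc e))) space

-- β_k(d) ≥ k for 1 ≤ k < 2^d: take k nonzero vectors; if they sum to zero,
-- replace one of them, x, by 0, which changes the sum to x ≠ 0.
lowerBound-tight : ∀ d k → 1 ≤ k → k < 2 ^ d → AdmissibleOfSize d k k
lowerBound-tight d (suc k) _ k-small = adjust (subsetOfSize (suc k) N N-big)
  where
  0∈ : zero^ d ∈ allVectors d
  0∈ = allVectors-complete (zero^ d)
  N : List (Z2^ d)
  N = remove 0∈
  uN : Unique N
  uN = Unique-⊆ (remove-⊆ 0∈) (allVectors-unique d)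
  0∉N : zero^ d ∉ N
  0∉N = remove-∉ (allVectors-unique d) 0∈
  N-big : suc k ≤ length N
  N-big = ≤-pred (subst (suc (suc k) ≤_) (trans (sym (allVectors-length d)) (remove-length 0∈)) k-small)
  adjust : Σ (List (Z2^ d)) (λ B → B ⊆ N × length B ≡ suc k) → AdmissibleOfSize d (suc k) (suc k)
  adjust (x ∷ rest , B⊆N , |B|) with vsum (x ∷ rest) ≟ zero^ d
  ... | no Σ≢0 = x ∷ rest , nonZeroSum⇒Admissible (suc k) _ (Unique-⊆ B⊆N uN) Σ≢0 |B| , |B|
  ... | yes Σ≡0 = zero^ d ∷ rest , nonZeroSum⇒Admissible (suc k) _ distinct Σ′≢0 |B| , |B|
    where
    rest⊆N : rest ⊆ N
    rest⊆N = ⊆-trans (x ∷ʳ ⊆-refl) B⊆N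
    distinct : Unique (zero^ d ∷ rest)
    distinct = ¬Any⇒All¬ rest (λ 0∈rest → 0∉N (Any-resp-⊆ rest⊆N 0∈rest)) ∷ Unique-⊆ rest⊆N uN
    x≢0 : x ≢ zero^ d
    x≢0 x≡0 = 0∉N (Any-resp-⊆ B⊆N (here (sym x≡0)))
    Σ′≢0 : zero^ d ⊕ vsum rest ≢ zero^ d
    Σ′≢0 Σ′≡0 = x≢0 (trans (⊕≡zero⇒≡ x (vsum rest) Σ≡0) (trans (sym (⊕-identityˡ (vsum rest))) Σ′≡0))

double-suc : ∀ m → 2 * suc m ≡ 2 * m + 2
double-suc = solve-∀

double-+2 : ∀ m → 2 * (m + 2) ≡ 2 * m + 4
double-+2 = solve-∀

double-3+ : ∀ m → 2 * (3 + m) ≡ suc (2 * m + 5)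
double-3+ = solve-∀

-- With H = 2^{d-1} and d ≥ 2: the generic case uses lowerBound (or the whole
-- space when 2m + 2 = 2^d) and upperBound; the case m = H - 2, i.e.
-- 2m + 4 = 2^d, uses lowerBound-tight and upperBound-tight.  d = 1 is
-- excluded by 1 ≤ m and 2m < 2.
theorem4 : (m d : ℕ) → 1 ≤ m → 1 ≤ d → 2 ^ (d ∸ 1) ≤ 2 * m → 2 * m < 2 ^ d →
    (m ≢ 2 ^ (d ∸ 1) ∸ 2 → IsBeta (2 * m) d (2 * m + 2))
    × (m ≡ 2 ^ (d ∸ 1) ∸ 2 → IsBeta (2 * m) d (2 * m))
theorem4 m (suc zero) m≥1 _ _ 2m<2 = ⊥-elim (<⇒≱ 2m<2 (*-monoʳ-≤ 2 m≥1))
theorem4 m (suc (suc e)) m≥1 _ H≤2m 2m<2H = generic , exceptional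
  where
  H : ℕ
  H = 2 ^ suc e
  m<H : m < H
  m<H = *-cancelˡ-< 2 m H 2m<2H
  generic : m ≢ H ∸ 2 → IsBeta (2 * m) (suc (suc e)) (2 * m + 2)
  generic m≢H-2 = existence (suc m ≟ℕ H) , upperBound (2 * m) H≤2m
    where
    existence : Dec (suc m ≡ H) → AdmissibleOfSize (suc (suc e)) (2 * m) (2 * m + 2)
    existence (yes 1+m≡H) = lowerBound-full e (2 * m) (trans (cong (2 *_) (sym 1+m≡H)) (double-suc m))
    existence (no 1+m≢H)  = lowerBound (suc e) (2 * m) H≤2m
      (≤-trans (n≤1+n _) (subst (_≤ 2 * H) (double-3+ m) (*-monoʳ-≤ 2 3+m≤H)))
      where
      3+m≤H : 3 + m ≤ H
      3+m≤H = ≤∧≢⇒< (≤∧≢⇒< m<H 1+m≢H) (λ 2+m≡H → m≢H-2 (cong (_∸ 2) 2+m≡H))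
  exceptional : m ≡ H ∸ 2 → IsBeta (2 * m) (suc (suc e)) (2 * m)
  exceptional m≡H-2 = lowerBound-tight _ (2 * m) (≤-trans (s≤s z≤n) (*-monoʳ-≤ 2 m≥1)) 2m<2H ,
                      upperBound-tight (2 * m) (trans (cong (2 *_) H≡m+2) (double-+2 m))
    where
    H≡m+2 : H ≡ m + 2
    H≡m+2 = trans (sym (m∸n+n≡m (≤-trans (s≤s m≥1) m<H))) (cong (_+ 2) (sym m≡H-2))
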